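{- Let $m\geq 3$ and let $G=S(3,1^{m-1})$ be the starlike tree of order $m+3$ (the tree on vertices $o,x_1,\dots,x_m,y,z$ with edges $ox_1,\dots,ox_m,x_1y,yz$). Then $b(G)=\frac{m^2+m-4}{2}$.
   Context: All graphs are finite and simple. For vertices $u,v$ of a graph $G$, $d_G(u,v)$ is the length of a shortest $u$–$v$ path. For an edge $xy$ of $G$, $W^G_{xy}=\{u\in V(G): d_G(u,x)<d_G(u,y)\}$. A graph is distance-balanced if $|W^G_{xy}|=|W^G_{yx}|$ for every edge $xy$. For a graph $H$, $b(H)$ is the smallest number of edges which can be added to $H$ (keeping the vertex set) so that the resulting graph is distance-balanced. A starlike tree is a tree with exactly one vertex of degree greater than two; $S(n_1^{\alpha_1},\dots,n_k^{\alpha_k})$ denotes the starlike tree in which deleting the central vertex leaves $\alpha_i$ paths with $n_i$ vertices for each $i$. -}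

module Defs where

open import Data.Nat using (ℕ; zero; suc; _+_; _≤_; _<ᵇ_; _≡ᵇ_)
open import Data.Bool using (Bool; true; false; _∧_; _∨_; if_then_else_)
open import Data.Fin using (Fin; toℕ)
open import Data.List using (List; allFin; filter; length; map; concatMap)
open import Data.Bool.ListAction using (any)
open import Data.Maybe using (Maybe; just; nothing)
open import Data.Product using (Σ; _×_; _,_)
open import Relation.Binary.PropositionalEquality using (_≡_)
open import Relation.Nullary.Decidable using (Dec)
open import Data.Bool.Properties using (T?)
open import Data.Bool using (T)

record Graph (n : ℕ) : Set where
  constructor mkGraph
  field
    adj : Fin n → Fin n → Bool

open Graph public

IsSimple : ∀ {n} → Graph n → Set
IsSimple {n} G = (∀ (u v : Fin n) → adj G u v ≡ adj G v u) × (∀ (u : Fin n) → adj G u u ≡ false)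

reach : ∀ {n} → Graph n → ℕ → Fin n → Fin n → Bool
reach G zero    u v = toℕ u ≡ᵇ toℕ v
reach G (suc k) u v = reach G k u v ∨ any (λ w → reach G k u w ∧ adj G w v) (allFin _)

distSearch : ∀ {n} → Graph n → (fuel k : ℕ) → Fin n → Fin n → Maybe ℕ
distSearch G zero       k u v = nothing
distSearch G (suc fuel) k u v = if reach G k u v then just k else distSearch G fuel (suc k) u v

-- Distance d_G(u,v) (length of a shortest u–v path); nothing = ∞ (no path).
-- Any shortest path has length < n, so searching k = 0,…,n suffices.
dist : ∀ {n} → Graph n → Fin n → Fin n → Maybe ℕ
dist {n} G u v = distSearch G (suc n) 0 u v

_<∞_ : Maybe ℕ → Maybe ℕ → Bool
just a  <∞ just b  = a <ᵇ b
just a  <∞ nothing = true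
nothing <∞ _       = false

W : ∀ {n} → Graph n → Fin n → Fin n → List (Fin n)
W G x y = filter (λ u → T? (dist G u x <∞ dist G u y)) (allFin _)

∣W∣ : ∀ {n} → Graph n → Fin n → Fin n → ℕ
∣W∣ G x y = length (W G x y)

DistanceBalanced : ∀ {n} → Graph n → Set
DistanceBalanced {n} G = ∀ (x y : Fin n) → adj G x y ≡ true → ∣W∣ G x y ≡ ∣W∣ G y x

numEdges : ∀ {n} → Graph n → ℕ
numEdges {n} G =
  length (filter (λ p → T? (pairOk p))
    (concatMap (λ i → map (λ j → (i , j)) (allFin n)) (allFin n)))
  where
  pairOk : Fin n × Fin n → Bool
  pairOk (i , j) = (toℕ i <ᵇ toℕ j) ∧ adj G i j

_⊆G_ : ∀ {n} → Graph n → Graph n → Set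
_⊆G_ {n} G H = ∀ (u v : Fin n) → adj G u v ≡ true → adj H u v ≡ true

IsBalancingNumber : ∀ {n} → Graph n → ℕ → Set
IsBalancingNumber {n} G N =
  Σ (Graph n) (λ H → IsSimple H × G ⊆G H × DistanceBalanced H × numEdges H ≡ numEdges G + N)
  × (∀ (H : Graph n) → IsSimple H → G ⊆G H → DistanceBalanced H → numEdges G + N ≤ numEdges H)

-- The starlike tree S(3,1^{m-1}) on vertex set Fin (m+3):
--   o = 0, x_i = i (1 ≤ i ≤ m), y = m+1, z = m+2;
--   edges o x_i (1 ≤ i ≤ m), x_1 y, y z.
starEdge : ℕ → ℕ → ℕ → Bool
starEdge m a b =
  ((a ≡ᵇ 0) ∧ (0 <ᵇ b) ∧ (b <ᵇ suc m))
  ∨ ((a ≡ᵇ 1) ∧ (b ≡ᵇ suc m))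
  ∨ ((a ≡ᵇ suc m) ∧ (b ≡ᵇ suc (suc m)))

S3-1 : (m : ℕ) → Graph (m + 3)
S3-1 m = mkGraph (λ u v → starEdge m (toℕ u) (toℕ v) ∨ starEdge m (toℕ v) (toℕ u))

-- In a connected graph, |W_xy| + Tr x = |W_yx| + Tr y for every edge xy, where Tr v = ∑_u d(u,v) is
-- the transmission; so a connected graph is distance-balanced iff Tr is constant along its edges.
-- Write n = m + 3 and let o be the centre, x₁,…,xₘ its neighbours, x₁ y z the long leg.
--
-- Let H ⊇ G be distance-balanced. As G is a spanning tree, Tr is constant on H. Routing
-- through the tree, Tr o ≤ (n − 1) + D with D = d(z,o) ≤ 3, while every v has Tr v ≥ (n − 1) + (number
-- of non-neighbours of v). So every vertex has at most D non-neighbours. If D = 3, then z is adjacent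
-- to none of o, x₁,…,xₘ, which are m + 1 > 3 non-neighbours; hence D ≤ 2, every degree is at least m,
-- and 2|E(H)| ≥ nm = 2(|E(G)| + (m² + m − 4)/2).
--
-- The Hamiltonian cycle o z x₁ x₂ ⋯ xₘ y o shares no edge with G, so its complement
-- contains G. That complement is (n − 3)-regular and has diameter 2 (n ≥ 5), so Tr v = 2(n − 1) − (n − 3)
-- for every v: it is distance-balanced and has exactly nm/2 edges.

module Submission where

open import Defs
open import Data.Nat
  using (ℕ; zero; suc; _+_; _*_; _∸_; _/_; _≤_; _<_; _≤′_; ≤′-refl; ≤′-step; _<ᵇ_; _≡ᵇ_; z≤n; s≤s)
open import Data.Nat.Properties
open import Data.Nat.DivMod using (m*n/n≡m)
open import Data.Nat.Tactic.RingSolver using (solve)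
open import Data.Bool using (Bool; true; false; _∧_; _∨_; not; if_then_else_)
open import Data.Bool.Properties using (T-≡; ∨-zeroʳ; ∧-zeroʳ; ∧-comm)
open import Data.Fin using (Fin; toℕ; fromℕ<) renaming (zero to fzero; suc to fsuc)
open import Data.Fin.Properties using (toℕ-injective; toℕ<n; toℕ-fromℕ<)
open import Data.List using (List; _++_; filter; length; map; concatMap; tabulate; allFin; _∷_; [])
open import Data.List.Properties using (length-++; filter-++; map-tabulate)
open import Data.List.Relation.Unary.Any using (satisfied)
open import Data.List.Relation.Unary.Any.Properties using (any⁺; any⁻)
open import Data.List.Membership.Propositional using (lose)
open import Data.List.Membership.Propositional.Properties using (∈-allFin)
open import Data.Bool.ListAction using (any)
open import Data.Product using (∃; _×_; _,_; proj₁; proj₂)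
open import Data.Sum using (_⊎_; inj₁; inj₂)
open import Data.Empty using (⊥-elim)
open import Data.Maybe using (just; fromMaybe)
open import Relation.Binary.PropositionalEquality
open import Relation.Binary.Definitions using (tri<; tri≈; tri>)
open import Relation.Nullary using (¬_; Dec; yes; no; does)
open import Relation.Nullary.Decidable using (T?; dec-true; dec-false; does-⇔)
open import Function using (_∘_; Equivalence; mk⇔)
open import Algebra.Properties.Semiring.Sum +-*-semiring
  using (sum; sum-syntax; sum-cong-≗; ∑-distrib-+; ∑-comm; *-distribˡ-sum; *-distribʳ-sum)

open Equivalence using (to; from)

dec-true⁻¹ : ∀ {a} {A : Set a} (a? : Dec A) → does a? ≡ true → A
dec-true⁻¹ (yes a) _ = a

dec-false⁻¹ : ∀ {a} {A : Set a} (a? : Dec A) → does a? ≡ false → ¬ A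
dec-false⁻¹ (no ¬a) _ = ¬a

∨-true⁻¹ : ∀ {x y} → x ∨ y ≡ true → x ≡ true ⊎ y ≡ true
∨-true⁻¹ {true}  _ = inj₁ refl
∨-true⁻¹ {false} e = inj₂ e

∧-true⁻¹ : ∀ {x y} → x ∧ y ≡ true → x ≡ true × y ≡ true
∧-true⁻¹ {true} {true} _ = refl , refl

not-true⁻¹ : ∀ {b} → not b ≡ true → b ≡ false
not-true⁻¹ {false} _ = refl

≡ᵇ-refl : ∀ a → (a ≡ᵇ a) ≡ true
≡ᵇ-refl a = dec-true (a ≟ a) refl

≡ᵇ-≢ : ∀ {a b} → a ≢ b → (a ≡ᵇ b) ≡ false
≡ᵇ-≢ {a} {b} = dec-false (a ≟ b)

𝟙 : Bool → ℕ
𝟙 true  = 1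
𝟙 false = 0

𝟙-∧ : ∀ x y → 𝟙 (x ∧ y) ≡ 𝟙 x * 𝟙 y
𝟙-∧ true  y = sym (+-identityʳ (𝟙 y))
𝟙-∧ false y = refl

𝟙-∨ : ∀ x y → (x ≡ true → y ≡ false) → 𝟙 (x ∨ y) ≡ 𝟙 x + 𝟙 y
𝟙-∨ true  y disjoint rewrite disjoint refl = refl
𝟙-∨ false y _        = refl

𝟙-≤ : ∀ {b k} → (b ≡ true → 1 ≤ k) → 𝟙 b ≤ k
𝟙-≤ {true}  1≤k = 1≤k refl
𝟙-≤ {false} _   = z≤n

∑-const : ∀ n c → ∑[ i < n ] c ≡ n * c
∑-const zero    c = refl
∑-const (suc n) c = cong (c +_) (∑-const n c)

∑-one : ∀ n → ∑[ i < n ] 1 ≡ n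
∑-one n = trans (∑-const n 1) (*-identityʳ n)

∑-zero : ∀ n → ∑[ i < n ] 0 ≡ 0
∑-zero n = trans (∑-const n 0) (*-zeroʳ n)

∑-mono-≤ : ∀ {n} {f g : Fin n → ℕ} → (∀ i → f i ≤ g i) → sum f ≤ sum g
∑-mono-≤ {zero}  f≤g = z≤n
∑-mono-≤ {suc n} f≤g = +-mono-≤ (f≤g fzero) (∑-mono-≤ (f≤g ∘ fsuc))

∑∑-cong : ∀ {n} {f g : Fin n → Fin n → ℕ} → (∀ i j → f i j ≡ g i j) →
          ∑[ i < n ] ∑[ j < n ] f i j ≡ ∑[ i < n ] ∑[ j < n ] g i j
∑∑-cong f≗g = sum-cong-≗ (λ i → sum-cong-≗ (f≗g i))

∑∑-distrib-+ : ∀ n (f g : Fin n → Fin n → ℕ) →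
               ∑[ i < n ] ∑[ j < n ] (f i j + g i j) ≡ ∑[ i < n ] ∑[ j < n ] f i j + ∑[ i < n ] ∑[ j < n ] g i j
∑∑-distrib-+ n f g =
  trans (sum-cong-≗ (λ i → ∑-distrib-+ (f i) (g i))) (∑-distrib-+ (λ i → sum (f i)) (λ i → sum (g i)))

∑∑-𝟙-∧ : ∀ n (p q : Fin n → Bool) →
         ∑[ i < n ] ∑[ j < n ] 𝟙 (p i ∧ q j) ≡ (∑[ i < n ] 𝟙 (p i)) * (∑[ j < n ] 𝟙 (q j))
∑∑-𝟙-∧ n p q = begin
  ∑[ i < n ] ∑[ j < n ] 𝟙 (p i ∧ q j)
    ≡⟨ ∑∑-cong (λ i j → 𝟙-∧ (p i) (q j)) ⟩
  ∑[ i < n ] ∑[ j < n ] (𝟙 (p i) * 𝟙 (q j))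
    ≡⟨ sum-cong-≗ (λ i → *-distribˡ-sum (𝟙 (p i)) (𝟙 ∘ q)) ⟨
  ∑[ i < n ] (𝟙 (p i) * ∑[ j < n ] 𝟙 (q j))
    ≡⟨ *-distribʳ-sum (∑[ j < n ] 𝟙 (q j)) (𝟙 ∘ p) ⟨
  (∑[ i < n ] 𝟙 (p i)) * (∑[ j < n ] 𝟙 (q j)) ∎
  where open ≡-Reasoning

∑-𝟙-≡ᵇ : ∀ n c → c < n → ∑[ i < n ] 𝟙 (toℕ i ≡ᵇ c) ≡ 1
∑-𝟙-≡ᵇ (suc n) zero    _         = cong suc (∑-zero n)
∑-𝟙-≡ᵇ (suc n) (suc c) (s≤s c<n) = ∑-𝟙-≡ᵇ n c c<n

∑-𝟙-<ᵇ : ∀ n c → c ≤ n → ∑[ i < n ] 𝟙 (toℕ i <ᵇ c) ≡ c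
∑-𝟙-<ᵇ n       zero    _         = ∑-zero n
∑-𝟙-<ᵇ (suc n) (suc c) (s≤s c≤n) = cong suc (∑-𝟙-<ᵇ n c c≤n)

∑-𝟙-between : ∀ n c → c < n → ∑[ i < n ] 𝟙 ((0 <ᵇ toℕ i) ∧ (toℕ i <ᵇ suc c)) ≡ c
∑-𝟙-between (suc n) c (s≤s c≤n) = ∑-𝟙-<ᵇ n c c≤n

∑-𝟙-witness : ∀ {n} (p : Fin n → Bool) → 1 ≤ ∑[ i < n ] 𝟙 (p i) → ∃ λ i → p i ≡ true
∑-𝟙-witness {suc n} p h with p fzero in eq
... | true  = fzero , eq
... | false = let i , pi = ∑-𝟙-witness (p ∘ fsuc) h in fsuc i , pi

count-tabulate : ∀ {A : Set} n (f : Fin n → A) (b : A → Bool) →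
                 length (filter (T? ∘ b) (tabulate f)) ≡ ∑[ i < n ] 𝟙 (b (f i))
count-tabulate zero    f b = refl
count-tabulate (suc n) f b with b (f fzero)
... | true  = cong suc (count-tabulate n (f ∘ fsuc) b)
... | false = count-tabulate n (f ∘ fsuc) b

count-concatMap : ∀ {A B : Set} n (f : Fin n → A) (g : A → List B) (b : B → Bool) →
                  length (filter (T? ∘ b) (concatMap g (tabulate f)))
                    ≡ ∑[ i < n ] length (filter (T? ∘ b) (g (f i)))
count-concatMap zero    f g b = refl
count-concatMap (suc n) f g b = begin
  length (filter (T? ∘ b) (g (f fzero) ++ concatMap g (tabulate (f ∘ fsuc))))
    ≡⟨ cong length (filter-++ (T? ∘ b) (g (f fzero)) _) ⟩
  length (filter (T? ∘ b) (g (f fzero)) ++ filter (T? ∘ b) (concatMap g (tabulate (f ∘ fsuc))))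
    ≡⟨ length-++ (filter (T? ∘ b) (g (f fzero))) ⟩
  length (filter (T? ∘ b) (g (f fzero))) + length (filter (T? ∘ b) (concatMap g (tabulate (f ∘ fsuc))))
    ≡⟨ cong (length (filter (T? ∘ b) (g (f fzero))) +_) (count-concatMap n (f ∘ fsuc) g b) ⟩
  ∑[ i < suc n ] length (filter (T? ∘ b) (g (f i))) ∎
  where open ≡-Reasoning

any-allFin⁺ : ∀ {n} (p : Fin n → Bool) i → p i ≡ true → any p (allFin n) ≡ true
any-allFin⁺ p i e = to T-≡ (any⁺ p (lose (∈-allFin i) (from T-≡ e)))

any-allFin⁻ : ∀ {n} (p : Fin n → Bool) → any p (allFin n) ≡ true → ∃ λ i → p i ≡ true
any-allFin⁻ {n} p e = let i , pi = satisfied (any⁻ p (allFin n) (from T-≡ e)) in i , to T-≡ pi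

-- Vertex equality as a Boolean, in the form in which `reach K 0` tests it.
_==_ : ∀ {n} → Fin n → Fin n → Bool
u == v = toℕ u ≡ᵇ toℕ v

==⇒≡ : ∀ {n} {u v : Fin n} → u == v ≡ true → u ≡ v
==⇒≡ {u = u} {v} e = toℕ-injective (dec-true⁻¹ (toℕ u ≟ toℕ v) e)

==-refl : ∀ {n} (u : Fin n) → u == u ≡ true
==-refl u = dec-true (toℕ u ≟ toℕ u) refl

==-≢ : ∀ {n} {u v : Fin n} → u ≢ v → u == v ≡ false
==-≢ {u = u} {v} u≢v = dec-false (toℕ u ≟ toℕ v) (u≢v ∘ toℕ-injective)

==-false⇒≢ : ∀ {n} {u v : Fin n} → u == v ≡ false → u ≢ v
==-false⇒≢ {u = u} {v} e = dec-false⁻¹ (toℕ u ≟ toℕ v) e ∘ cong toℕ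

==-via : ∀ {n} {u w : Fin n} {a b} → toℕ u ≡ a → toℕ w ≡ b → u == w ≡ (a ≡ᵇ b)
==-via = cong₂ _≡ᵇ_

==-comm : ∀ {n} (u v : Fin n) → u == v ≡ v == u
==-comm u v = does-⇔ (mk⇔ sym sym) (toℕ u ≟ toℕ v) (toℕ v ≟ toℕ u)

∑-𝟙-== : ∀ {n} (v : Fin n) → ∑[ u < n ] 𝟙 (u == v) ≡ 1
∑-𝟙-== {n} v = ∑-𝟙-≡ᵇ n (toℕ v) (toℕ<n v)

∑-𝟙-≢ : ∀ {n} (v : Fin n) → ∑[ u < n ] 𝟙 (not (u == v)) + 1 ≡ n
∑-𝟙-≢ {n} v = begin
  ∑[ u < n ] 𝟙 (not (u == v)) + 1
    ≡⟨ cong (∑[ u < n ] 𝟙 (not (u == v)) +_) (sym (∑-𝟙-== v)) ⟩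
  ∑[ u < n ] 𝟙 (not (u == v)) + ∑[ u < n ] 𝟙 (u == v)
    ≡⟨ sym (∑-distrib-+ (λ u → 𝟙 (not (u == v))) (λ u → 𝟙 (u == v))) ⟩
  ∑[ u < n ] (𝟙 (not (u == v)) + 𝟙 (u == v))
    ≡⟨ sum-cong-≗ (λ u → complement (u == v)) ⟩
  ∑[ u < n ] 1
    ≡⟨ ∑-one n ⟩
  n ∎
  where
  open ≡-Reasoning
  complement : ∀ b → 𝟙 (not b) + 𝟙 b ≡ 1
  complement true  = refl
  complement false = refl

∑-𝟙-remove : ∀ {n} (p : Fin n → Bool) a → ∑[ w < n ] 𝟙 (p w) ≤ 1 + ∑[ w < n ] 𝟙 (p w ∧ not (w == a))
∑-𝟙-remove {n} p a = begin
  ∑[ w < n ] 𝟙 (p w)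
    ≤⟨ ∑-mono-≤ (λ w → split (p w) (w == a)) ⟩
  ∑[ w < n ] (𝟙 (w == a) + 𝟙 (p w ∧ not (w == a)))
    ≡⟨ ∑-distrib-+ (λ w → 𝟙 (w == a)) (λ w → 𝟙 (p w ∧ not (w == a))) ⟩
  ∑[ w < n ] 𝟙 (w == a) + ∑[ w < n ] 𝟙 (p w ∧ not (w == a))
    ≡⟨ cong (_+ ∑[ w < n ] 𝟙 (p w ∧ not (w == a))) (∑-𝟙-== a) ⟩
  1 + ∑[ w < n ] 𝟙 (p w ∧ not (w == a)) ∎
  where
  open ≤-Reasoning
  split : ∀ x y → 𝟙 x ≤ 𝟙 y + 𝟙 (x ∧ not y)
  split false _     = z≤n
  split true  false = s≤s z≤n
  split true  true  = s≤s z≤n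

avoid₄ : ∀ {n} → 4 < n → (a b c e : Fin n) → ∃ λ w → w ≢ a × w ≢ b × w ≢ c × w ≢ e
avoid₄ {n} 4<n a b c e =
  let w , qw = ∑-𝟙-witness avoids (+-cancelˡ-≤ 4 1 (∑[ w < n ] 𝟙 (avoids w)) (≤-trans 4<n count))
      qwabc , w≠e = ∧-true⁻¹ qw
      qwab  , w≠c = ∧-true⁻¹ qwabc
      w≠a   , w≠b = ∧-true⁻¹ qwab
  in w , distinct w≠a , distinct w≠b , distinct w≠c , distinct w≠e
  where
  avoids : Fin n → Bool
  avoids w = ((not (w == a) ∧ not (w == b)) ∧ not (w == c)) ∧ not (w == e)
  distinct : ∀ {w x} → not (w == x) ≡ true → w ≢ x
  distinct = ==-false⇒≢ ∘ not-true⁻¹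
  count : n ≤ 4 + ∑[ w < n ] 𝟙 (avoids w)
  count = begin
    n
      ≡⟨ ∑-one n ⟨
    ∑[ w < n ] 1
      ≤⟨ ∑-𝟙-remove (λ _ → true) a ⟩
    1 + ∑[ w < n ] 𝟙 (not (w == a))
      ≤⟨ s≤s (∑-𝟙-remove _ b) ⟩
    2 + ∑[ w < n ] 𝟙 (not (w == a) ∧ not (w == b))
      ≤⟨ s≤s (s≤s (∑-𝟙-remove _ c)) ⟩
    3 + ∑[ w < n ] 𝟙 ((not (w == a) ∧ not (w == b)) ∧ not (w == c))
      ≤⟨ s≤s (s≤s (s≤s (∑-𝟙-remove _ e))) ⟩
    4 + ∑[ w < n ] 𝟙 (avoids w) ∎
    where open ≤-Reasoning

-- Walks and distances

module _ {n} (K : Graph n) where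

  reach-suc : ∀ k u v → reach K k u v ≡ true → reach K (suc k) u v ≡ true
  reach-suc k u v e rewrite e = refl

  reach-mono : ∀ {j} k u v → j ≤ k → reach K j u v ≡ true → reach K k u v ≡ true
  reach-mono _ u v = go ∘ ≤⇒≤′
    where
    go : ∀ {j k} → j ≤′ k → reach K j u v ≡ true → reach K k u v ≡ true
    go ≤′-refl           r = r
    go (≤′-step {k} j≤k) r = reach-suc k u v (go j≤k r)

  reach-step : ∀ k u w v → reach K k u w ≡ true → adj K w v ≡ true → reach K (suc k) u v ≡ true
  reach-step k u w v r a =
    trans (cong (reach K k u v ∨_) (any-allFin⁺ (λ x → reach K k u x ∧ adj K x v) w (cong₂ _∧_ r a)))
          (∨-zeroʳ _)

  reach-suc⁻¹ : ∀ k u v → reach K (suc k) u v ≡ true →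
                reach K k u v ≡ true ⊎ ∃ λ w → reach K k u w ≡ true × adj K w v ≡ true
  reach-suc⁻¹ k u v r with ∨-true⁻¹ {reach K k u v} r
  ... | inj₁ r′ = inj₁ r′
  ... | inj₂ e  = let w , rw = any-allFin⁻ (λ x → reach K k u x ∧ adj K x v) e
                  in inj₂ (w , ∧-true⁻¹ {reach K k u w} rw)

  reach-refl : ∀ u → reach K 0 u u ≡ true
  reach-refl = ==-refl

  reach-zero⇒≡ : ∀ u v → reach K 0 u v ≡ true → u ≡ v
  reach-zero⇒≡ u v = ==⇒≡

  reach-trans : ∀ a b u w v → reach K a u w ≡ true → reach K b w v ≡ true → reach K (a + b) u v ≡ true
  reach-trans a zero u w v r₁ r₂ with refl ← reach-zero⇒≡ w v r₂ rewrite +-identityʳ a = r₁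
  reach-trans a (suc b) u w v r₁ r₂ rewrite +-suc a b with reach-suc⁻¹ b w v r₂
  ... | inj₁ r            = reach-suc (a + b) u v (reach-trans a b u w v r₁ r)
  ... | inj₂ (x , r , ax) = reach-step (a + b) u x v (reach-trans a b u w x r₁ r) ax

  adj⇒reach : ∀ u v → adj K u v ≡ true → reach K 1 u v ≡ true
  adj⇒reach u v = reach-step 0 u u v (reach-refl u)

  reach-one⁻¹ : ∀ u v → reach K 1 u v ≡ true → u ≡ v ⊎ adj K u v ≡ true
  reach-one⁻¹ u v r with reach-suc⁻¹ 0 u v r
  ... | inj₁ r₀                                            = inj₁ (reach-zero⇒≡ u v r₀)
  ... | inj₂ (w , r₀ , a) with refl ← reach-zero⇒≡ u w r₀ = inj₂ a

  reach-sym : (∀ u v → adj K u v ≡ adj K v u) → ∀ k u v → reach K k u v ≡ true → reach K k v u ≡ true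
  reach-sym adj-sym zero u v r with refl ← reach-zero⇒≡ u v r = reach-refl u
  reach-sym adj-sym (suc k) u v r with reach-suc⁻¹ k u v r
  ... | inj₁ r′          = reach-suc k v u (reach-sym adj-sym k u v r′)
  ... | inj₂ (x , r′ , a) =
    reach-trans 1 k v x u (adj⇒reach v x (trans (adj-sym v x) a)) (reach-sym adj-sym k u x r′)

  IsShortest : Fin n → Fin n → ℕ → Set
  IsShortest u v d = reach K d u v ≡ true × (∀ k → reach K k u v ≡ true → d ≤ k)

  distSearch-spec : ∀ {u v c} fuel k → (∀ j → j < k → reach K j u v ≡ false) →
                    reach K c u v ≡ true → c < k + fuel →
                    ∃ λ d → distSearch K fuel k u v ≡ just d × IsShortest u v d
  distSearch-spec {c = c} zero k below r c<k
    with () ← trans (sym r) (below c (subst (c <_) (+-identityʳ k) c<k))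
  distSearch-spec {u} {v} {c} (suc fuel) k below r c<k+1+fuel with reach K k u v in eq
  ... | true  = k , refl , eq , λ j rj → ≮⇒≥ (λ j<k → true≢false (trans (sym rj) (below j j<k)))
    where
    true≢false : true ≢ false
    true≢false ()
  ... | false = distSearch-spec fuel (suc k) below′ r (subst (c <_) (+-suc k fuel) c<k+1+fuel)
    where
    below′ : ∀ j → j < suc k → reach K j u v ≡ false
    below′ j j<1+k with m≤n⇒m<n∨m≡n (≤-pred j<1+k)
    ... | inj₁ j<k  = below j j<k
    ... | inj₂ refl = eq

  dist-spec : ∀ {c u v} → c ≤ n → reach K c u v ≡ true → ∃ λ d → dist K u v ≡ just d × IsShortest u v d
  dist-spec c≤n r = distSearch-spec (suc n) 0 (λ _ ()) r (s≤s c≤n)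

degree : ∀ {n} → Graph n → Fin n → ℕ
degree {n} K v = ∑[ u < n ] 𝟙 (adj K u v)

nonNeighbours : ∀ {n} → Graph n → Fin n → ℕ
nonNeighbours {n} K v = ∑[ u < n ] 𝟙 (not (u == v) ∧ not (adj K u v))

degree+nonNeighbours : ∀ {n} (K : Graph n) → IsSimple K → ∀ v → degree K v + nonNeighbours K v + 1 ≡ n
degree+nonNeighbours {n} K (_ , irrefl) v = begin
  degree K v + nonNeighbours K v + 1
    ≡⟨ cong (degree K v + nonNeighbours K v +_) (sym (∑-𝟙-== v)) ⟩
  degree K v + nonNeighbours K v + ∑[ u < n ] 𝟙 (u == v)
    ≡⟨ cong (_+ ∑[ u < n ] 𝟙 (u == v)) (sym (∑-distrib-+ isNeighbour isNonNeighbour)) ⟩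
  ∑[ u < n ] (isNeighbour u + isNonNeighbour u) + ∑[ u < n ] 𝟙 (u == v)
    ≡⟨ sym (∑-distrib-+ (λ u → isNeighbour u + isNonNeighbour u) (λ u → 𝟙 (u == v))) ⟩
  ∑[ u < n ] (isNeighbour u + isNonNeighbour u + 𝟙 (u == v))
    ≡⟨ sum-cong-≗ (λ u → partition (u == v) (adj K u v) (irreflexive u)) ⟩
  ∑[ u < n ] 1
    ≡⟨ ∑-one n ⟩
  n ∎
  where
  open ≡-Reasoning
  irreflexive : ∀ u → u == v ≡ true → adj K u v ≡ false
  irreflexive u e = subst (λ w → adj K w v ≡ false) (sym (==⇒≡ e)) (irrefl v)
  isNeighbour isNonNeighbour : Fin n → ℕ
  isNeighbour u = 𝟙 (adj K u v)
  isNonNeighbour u = 𝟙 (not (u == v) ∧ not (adj K u v))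
  partition : ∀ e a → (e ≡ true → a ≡ false) → 𝟙 a + 𝟙 (not e ∧ not a) + 𝟙 e ≡ 1
  partition true  true  a≡false with () ← a≡false refl
  partition true  false _ = refl
  partition false true  _ = refl
  partition false false _ = refl

𝟙-nonNeighbour : ∀ {n} (K : Graph n) {u v} → u == v ≡ false → adj K u v ≡ false →
                 𝟙 (not (u == v) ∧ not (adj K u v)) ≡ 1
𝟙-nonNeighbour K u≠v ¬uv rewrite u≠v | ¬uv = refl

numEdges-∑ : ∀ {n} (K : Graph n) → numEdges K ≡ ∑[ i < n ] ∑[ j < n ] 𝟙 ((toℕ i <ᵇ toℕ j) ∧ adj K i j)
numEdges-∑ {n} K = trans (count-concatMap n (λ i → i) _ ordered) (sum-cong-≗ row)
  where
  ordered : Fin n × Fin n → Bool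
  ordered (i , j) = (toℕ i <ᵇ toℕ j) ∧ adj K i j
  row : ∀ i → length (filter (T? ∘ ordered) (map (i ,_) (allFin n))) ≡ ∑[ j < n ] 𝟙 (ordered (i , j))
  row i = trans (cong (length ∘ filter (T? ∘ ordered)) (map-tabulate (λ j → j) (i ,_)))
                (count-tabulate n (i ,_) ordered)

handshake : ∀ {n} (K : Graph n) → IsSimple K → 2 * numEdges K ≡ ∑[ v < n ] degree K v
handshake {n} K (adj-sym , irrefl) = begin
  2 * numEdges K
    ≡⟨ cong (numEdges K +_) (+-identityʳ (numEdges K)) ⟩
  numEdges K + numEdges K
    ≡⟨ cong₂ _+_ (numEdges-∑ K) (trans (numEdges-∑ K) (∑-comm upward)) ⟩
  ∑[ i < n ] ∑[ j < n ] upward i j + ∑[ i < n ] ∑[ j < n ] upward j i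
    ≡⟨ ∑∑-distrib-+ n upward (λ i j → upward j i) ⟨
  ∑[ i < n ] ∑[ j < n ] (upward i j + upward j i)
    ≡⟨ ∑∑-cong either-way ⟩
  ∑[ i < n ] ∑[ j < n ] 𝟙 (adj K i j)
    ≡⟨ ∑-comm (λ i j → 𝟙 (adj K i j)) ⟩
  ∑[ v < n ] degree K v ∎
  where
  open ≡-Reasoning
  upward : Fin n → Fin n → ℕ
  upward i j = 𝟙 ((toℕ i <ᵇ toℕ j) ∧ adj K i j)
  either-way : ∀ i j → upward i j + upward j i ≡ 𝟙 (adj K i j)
  either-way i j rewrite adj-sym j i with adj K i j in aij
  ... | false rewrite ∧-zeroʳ (toℕ i <ᵇ toℕ j) | ∧-zeroʳ (toℕ j <ᵇ toℕ i) = refl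
  ... | true with <-cmp (toℕ i) (toℕ j)
  ... | tri< i<j _ j≮i rewrite dec-true (_ <? _) i<j | dec-false (_ <? _) j≮i = refl
  ... | tri> i≮j _ j<i rewrite dec-true (_ <? _) j<i | dec-false (_ <? _) i≮j = refl
  ... | tri≈ _ i≡j _ with refl ← toℕ-injective i≡j with () ← trans (sym aij) (irrefl i)

handshake-regular : ∀ {n} (K : Graph n) → IsSimple K → ∀ {r} → (∀ v → degree K v ≡ r) →
                    2 * numEdges K ≡ n * r
handshake-regular {n} K simple {r} regular =
  trans (handshake K simple) (trans (sum-cong-≗ regular) (∑-const n r))

handshake-minDegree : ∀ {n} (K : Graph n) → IsSimple K → ∀ {r} → (∀ v → r ≤ degree K v) →
                      n * r ≤ 2 * numEdges K
handshake-minDegree {n} K simple {r} r≤degree = begin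
  n * r                  ≡⟨ ∑-const n r ⟨
  ∑[ v < n ] r           ≤⟨ ∑-mono-≤ r≤degree ⟩
  ∑[ v < n ] degree K v  ≡⟨ handshake K simple ⟨
  2 * numEdges K         ∎
  where open ≤-Reasoning

-- Transmission

∣W∣-∑ : ∀ {n} (K : Graph n) x y → ∣W∣ K x y ≡ ∑[ u < n ] 𝟙 (dist K u x <∞ dist K u y)
∣W∣-∑ {n} K x y = count-tabulate n (λ u → u) _

-- min (d u v) 2, which depends on adjacency alone.
dist⊓2 : ∀ {n} → Graph n → Fin n → Fin n → ℕ
dist⊓2 K u v = 𝟙 (not (u == v)) + 𝟙 (not (u == v) ∧ not (adj K u v))

∑-dist⊓2 : ∀ {n} (K : Graph n) v → ∑[ u < n ] dist⊓2 K u v + 1 ≡ n + nonNeighbours K v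
∑-dist⊓2 {n} K v = begin
  ∑[ u < n ] dist⊓2 K u v + 1
    ≡⟨ cong (_+ 1) (∑-distrib-+ (λ u → 𝟙 (not (u == v))) (λ u → 𝟙 (not (u == v) ∧ not (adj K u v)))) ⟩
  ∑[ u < n ] 𝟙 (not (u == v)) + nonNeighbours K v + 1
    ≡⟨ +-assoc (∑[ u < n ] 𝟙 (not (u == v))) (nonNeighbours K v) 1 ⟩
  ∑[ u < n ] 𝟙 (not (u == v)) + (nonNeighbours K v + 1)
    ≡⟨ cong (∑[ u < n ] 𝟙 (not (u == v)) +_) (+-comm (nonNeighbours K v) 1) ⟩
  ∑[ u < n ] 𝟙 (not (u == v)) + (1 + nonNeighbours K v)
    ≡⟨ +-assoc (∑[ u < n ] 𝟙 (not (u == v))) 1 (nonNeighbours K v) ⟨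
  ∑[ u < n ] 𝟙 (not (u == v)) + 1 + nonNeighbours K v
    ≡⟨ cong (_+ nonNeighbours K v) (∑-𝟙-≢ v) ⟩
  n + nonNeighbours K v ∎
  where open ≡-Reasoning

𝟙-<ᵇ-+-swap : ∀ a b → a ≤ suc b → b ≤ suc a → 𝟙 (a <ᵇ b) + a ≡ 𝟙 (b <ᵇ a) + b
𝟙-<ᵇ-+-swap a b a≤1+b b≤1+a with <-cmp a b
... | tri< a<b _ b≮a rewrite dec-true (a <? b) a<b | dec-false (b <? a) b≮a = ≤-antisym a<b b≤1+a
... | tri≈ _ refl _  rewrite dec-false (a <? a) (<-irrefl refl)          = refl
... | tri> a≮b _ b<a rewrite dec-true (b <? a) b<a | dec-false (a <? b) a≮b = sym (≤-antisym b<a a≤1+b)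

module Connected {n} (K : Graph n) (adj-sym : ∀ u v → adj K u v ≡ adj K v u)
                 {c} (c≤n : c ≤ n) (reach-c : ∀ u v → reach K c u v ≡ true) where

  -- The default 0 is never used: reach-c makes every distance finite.
  d : Fin n → Fin n → ℕ
  d u v = fromMaybe 0 (dist K u v)

  private
    d-spec : ∀ u v → dist K u v ≡ just (d u v) × IsShortest K u v (d u v)
    d-spec u v with dist-spec K c≤n (reach-c u v)
    ... | _ , dist≡ , shortest rewrite dist≡ = refl , shortest

  dist≡d : ∀ u v → dist K u v ≡ just (d u v)
  dist≡d u v = proj₁ (d-spec u v)

  reach-d : ∀ u v → reach K (d u v) u v ≡ true
  reach-d u v = proj₁ (proj₂ (d-spec u v))

  d-minimal : ∀ k u v → reach K k u v ≡ true → d u v ≤ k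
  d-minimal k u v = proj₂ (proj₂ (d-spec u v)) k

  d-adj : ∀ u {x y} → adj K x y ≡ true → d u y ≤ suc (d u x)
  d-adj u {x} {y} a = d-minimal (suc (d u x)) u y (reach-step K (d u x) u x y (reach-d u x) a)

  d-self : ∀ u → d u u ≡ 0
  d-self u = n≤0⇒n≡0 (d-minimal 0 u u (reach-refl K u))

  1≤d : ∀ {u v} → u ≢ v → 1 ≤ d u v
  1≤d {u} {v} u≢v with d u v | reach-d u v
  ... | zero  | r = ⊥-elim (u≢v (reach-zero⇒≡ K u v r))
  ... | suc _ | _ = s≤s z≤n

  2≤d : ∀ {u v} → u ≢ v → adj K u v ≡ false → 2 ≤ d u v
  2≤d {u} {v} u≢v ¬uv with d u v | reach-d u v
  ... | zero        | r = ⊥-elim (u≢v (reach-zero⇒≡ K u v r))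
  ... | suc (suc _) | _ = s≤s (s≤s z≤n)
  ... | suc zero    | r with reach-one⁻¹ K u v r
  ...   | inj₁ u≡v = ⊥-elim (u≢v u≡v)
  ...   | inj₂ uv  with () ← trans (sym ¬uv) uv

  dist⊓2≤d : ∀ u v → dist⊓2 K u v ≤ d u v
  dist⊓2≤d u v = bound (u == v) (adj K u v) (1≤d {u} {v} ∘ ==-false⇒≢) (2≤d {u} {v} ∘ ==-false⇒≢)
    where
    bound : ∀ e a {k} → (e ≡ false → 1 ≤ k) → (e ≡ false → a ≡ false → 2 ≤ k) →
            𝟙 (not e) + 𝟙 (not e ∧ not a) ≤ k
    bound true  _     _   _   = z≤n
    bound false true  1≤k _   = 1≤k refl
    bound false false _   2≤k = 2≤k refl refl

  d≤dist⊓2 : c ≤ 2 → ∀ u v → d u v ≤ dist⊓2 K u v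
  d≤dist⊓2 c≤2 u v = cap (u == v) (adj K u v)
    (λ e → ≤-reflexive (trans (cong (d u) (sym (==⇒≡ e))) (d-self u)))
    (λ a → d-minimal 1 u v (adj⇒reach K u v a))
    (≤-trans (d-minimal c u v (reach-c u v)) c≤2)
    where
    cap : ∀ e a {k} → (e ≡ true → k ≤ 0) → (a ≡ true → k ≤ 1) → k ≤ 2 →
          k ≤ 𝟙 (not e) + 𝟙 (not e ∧ not a)
    cap true  _     k≤0 _   _   = k≤0 refl
    cap false true  _   k≤1 _   = k≤1 refl
    cap false false _   _   k≤2 = k≤2

  Tr : Fin n → ℕ
  Tr v = ∑[ u < n ] d u v

  -- Across the edge xy, d u x and d u y differ by at most 1, so each u closer to x than to y
  -- contributes exactly one more to Tr y than to Tr x.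
  ∣W∣+Tr : ∀ {x y} → adj K x y ≡ true → ∣W∣ K x y + Tr x ≡ ∣W∣ K y x + Tr y
  ∣W∣+Tr {x} {y} xy = begin
    ∣W∣ K x y + Tr x                     ≡⟨ cong (_+ Tr x) (∣W∣-∑ K x y) ⟩
    ∑[ u < n ] closer u x y + Tr x       ≡⟨ ∑-distrib-+ (λ u → closer u x y) (λ u → d u x) ⟨
    ∑[ u < n ] (closer u x y + d u x)    ≡⟨ sum-cong-≗ balance ⟩
    ∑[ u < n ] (closer u y x + d u y)    ≡⟨ ∑-distrib-+ (λ u → closer u y x) (λ u → d u y) ⟩
    ∑[ u < n ] closer u y x + Tr y       ≡⟨ cong (_+ Tr y) (∣W∣-∑ K y x) ⟨
    ∣W∣ K y x + Tr y                     ∎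
    where
    open ≡-Reasoning
    closer : Fin n → Fin n → Fin n → ℕ
    closer u a b = 𝟙 (dist K u a <∞ dist K u b)
    balance : ∀ u → closer u x y + d u x ≡ closer u y x + d u y
    balance u rewrite dist≡d u x | dist≡d u y =
      𝟙-<ᵇ-+-swap (d u x) (d u y) (d-adj u (trans (adj-sym y x) xy)) (d-adj u xy)

  distanceBalanced⇒Tr≡ : DistanceBalanced K → ∀ {x y} → adj K x y ≡ true → Tr x ≡ Tr y
  distanceBalanced⇒Tr≡ balanced {x} {y} xy =
    +-cancelˡ-≡ (∣W∣ K x y) (Tr x) (Tr y) (trans (∣W∣+Tr xy) (cong (_+ Tr y) (sym (balanced x y xy))))

  Tr≡⇒distanceBalanced : (∀ x y → Tr x ≡ Tr y) → DistanceBalanced K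
  Tr≡⇒distanceBalanced Tr≡ x y xy =
    +-cancelʳ-≡ (Tr x) (∣W∣ K x y) (∣W∣ K y x) (trans (∣W∣+Tr xy) (cong (∣W∣ K y x +_) (sym (Tr≡ x y))))

  n+nonNeighbours≤Tr+1 : ∀ v → n + nonNeighbours K v ≤ Tr v + 1
  n+nonNeighbours≤Tr+1 v = begin
    n + nonNeighbours K v          ≡⟨ ∑-dist⊓2 K v ⟨
    ∑[ u < n ] dist⊓2 K u v + 1    ≤⟨ +-monoˡ-≤ 1 (∑-mono-≤ (λ u → dist⊓2≤d u v)) ⟩
    Tr v + 1                       ∎
    where open ≤-Reasoning

  Tr+1≡n+nonNeighbours : c ≤ 2 → ∀ v → Tr v + 1 ≡ n + nonNeighbours K v
  Tr+1≡n+nonNeighbours c≤2 v = ≤-antisym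
    (begin
      Tr v + 1                     ≤⟨ +-monoˡ-≤ 1 (∑-mono-≤ (λ u → d≤dist⊓2 c≤2 u v)) ⟩
      ∑[ u < n ] dist⊓2 K u v + 1  ≡⟨ ∑-dist⊓2 K v ⟩
      n + nonNeighbours K v        ∎)
    (n+nonNeighbours≤Tr+1 v)
    where open ≤-Reasoning

-- Complement of the cycles of a permutation

module CycleComplement {n} (s p : Fin n → Fin n) (s∘p : ∀ v → s (p v) ≡ v) (p∘s : ∀ v → p (s v) ≡ v)
                       (s-fixfree : ∀ v → s v ≢ v) (s²-fixfree : ∀ v → s (s v) ≢ v) where

  graph : Graph n
  graph = mkGraph λ u v → not (u == v) ∧ not (v == s u) ∧ not (u == s v)

  s-injective : ∀ {u v} → s u ≡ s v → u ≡ v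
  s-injective {u} {v} su≡sv = trans (sym (p∘s u)) (trans (cong p su≡sv) (p∘s v))

  ==-s-p : ∀ u v → v == s u ≡ u == p v
  ==-s-p u v = does-⇔ (mk⇔ to′ from′) (toℕ v ≟ toℕ (s u)) (toℕ u ≟ toℕ (p v))
    where
    to′ : toℕ v ≡ toℕ (s u) → toℕ u ≡ toℕ (p v)
    to′ e = cong toℕ (trans (sym (p∘s u)) (cong p (sym (toℕ-injective e))))
    from′ : toℕ u ≡ toℕ (p v) → toℕ v ≡ toℕ (s u)
    from′ e = cong toℕ (trans (sym (s∘p v)) (cong s (sym (toℕ-injective e))))

  isSimple : IsSimple graph
  isSimple = adj-sym , irrefl
    where
    adj-sym : ∀ u v → adj graph u v ≡ adj graph v u
    adj-sym u v rewrite ==-comm u v = cong (not (v == u) ∧_) (∧-comm (not (v == s u)) (not (u == s v)))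
    irrefl : ∀ u → adj graph u u ≡ false
    irrefl u rewrite ==-refl u = refl

  adj-intro : ∀ {u v} → u ≢ v → v ≢ s u → u ≢ s v → adj graph u v ≡ true
  adj-intro u≢v v≢su u≢sv rewrite ==-≢ u≢v | ==-≢ v≢su | ==-≢ u≢sv = refl

  -- The non-neighbours of v are p v and s v, which are distinct.
  nonNeighbours≡2 : ∀ v → nonNeighbours graph v ≡ 2
  nonNeighbours≡2 v = begin
    nonNeighbours graph v
      ≡⟨ sum-cong-≗ (λ u → split (u == v) (u == p v) (u == s v)
                             (cong (λ b → not (u == v) ∧ not b ∧ not (u == s v)) (==-s-p u v))
                             (==-≢ ∘ p≢ u) (==-≢ ∘ s≢ u) (p≢s u)) ⟩
    ∑[ u < n ] (𝟙 (u == p v) + 𝟙 (u == s v))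
      ≡⟨ ∑-distrib-+ (λ u → 𝟙 (u == p v)) (λ u → 𝟙 (u == s v)) ⟩
    ∑[ u < n ] 𝟙 (u == p v) + ∑[ u < n ] 𝟙 (u == s v)
      ≡⟨ cong₂ _+_ (∑-𝟙-== (p v)) (∑-𝟙-== (s v)) ⟩
    2 ∎
    where
    open ≡-Reasoning
    p≢ : ∀ u → u == p v ≡ true → u ≢ v
    p≢ u e u≡v = s-fixfree v (trans (cong s (trans (sym u≡v) (==⇒≡ e))) (s∘p v))
    s≢ : ∀ u → u == s v ≡ true → u ≢ v
    s≢ u e u≡v = s-fixfree v (trans (sym (==⇒≡ e)) u≡v)
    p≢s : ∀ u → u == p v ≡ true → u == s v ≢ true
    p≢s u e₁ e₂ = s²-fixfree v (trans (cong s (trans (sym (==⇒≡ {u = u} e₂)) (==⇒≡ {u = u} e₁))) (s∘p v))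
    split : ∀ {a′} e a b → a′ ≡ not e ∧ not a ∧ not b →
            (a ≡ true → e ≡ false) → (b ≡ true → e ≡ false) → (a ≡ true → b ≢ true) →
            𝟙 (not e ∧ not a′) ≡ 𝟙 a + 𝟙 b
    split true  false false refl _   _   _   = refl
    split true  true  _     refl a⇒¬e _   _   with () ← a⇒¬e refl
    split true  false true  refl _   b⇒¬e _   with () ← b⇒¬e refl
    split false false false refl _   _   _   = refl
    split false true  false refl _   _   _   = refl
    split false false true  refl _   _   _   = refl
    split false true  true  refl _   _   a⇒¬b with () ← a⇒¬b refl refl

  degree+3 : ∀ v → degree graph v + 3 ≡ n
  degree+3 v = begin
    degree graph v + 3                          ≡⟨ +-assoc (degree graph v) 2 1 ⟨
    degree graph v + 2 + 1                      ≡⟨ cong (λ k → degree graph v + k + 1) (nonNeighbours≡2 v) ⟨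
    degree graph v + nonNeighbours graph v + 1  ≡⟨ degree+nonNeighbours graph isSimple v ⟩
    n                                           ∎
    where open ≡-Reasoning

  common-neighbour : 4 < n → ∀ u → ∃ λ w → adj graph u w ≡ true × adj graph w (s u) ≡ true
  common-neighbour 4<n u with avoid₄ 4<n u (s u) (p u) (s (s u))
  ... | w , w≢u , w≢su , w≢pu , w≢ssu =
    w , adj-intro (w≢u ∘ sym) w≢su (λ u≡sw → w≢pu (trans (sym (p∘s w)) (cong p (sym u≡sw))))
      , adj-intro w≢su (w≢u ∘ sym ∘ s-injective) w≢ssu

  adjacency-cases : ∀ u v → u ≡ v ⊎ v ≡ s u ⊎ u ≡ s v ⊎ adj graph u v ≡ true
  adjacency-cases u v with u == v in u=v | v == s u in v=su | u == s v in u=sv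
  ... | true  | _     | _     = inj₁ (==⇒≡ u=v)
  ... | false | true  | _     = inj₂ (inj₁ (==⇒≡ v=su))
  ... | false | false | true  = inj₂ (inj₂ (inj₁ (==⇒≡ u=sv)))
  ... | false | false | false = inj₂ (inj₂ (inj₂ refl))

  reach-successor : 4 < n → ∀ u → reach graph 2 u (s u) ≡ true
  reach-successor 4<n u =
    let w , uw , wsu = common-neighbour 4<n u
    in reach-trans graph 1 1 u w (s u) (adj⇒reach graph u w uw) (adj⇒reach graph w (s u) wsu)

  reach-two : 4 < n → ∀ u v → reach graph 2 u v ≡ true
  reach-two 4<n u v with adjacency-cases u v
  ... | inj₁ refl               = reach-mono graph 2 u u z≤n (reach-refl graph u)
  ... | inj₂ (inj₁ refl)        = reach-successor 4<n u
  ... | inj₂ (inj₂ (inj₁ refl)) = reach-sym graph (proj₁ isSimple) 2 v (s v) (reach-successor 4<n v)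
  ... | inj₂ (inj₂ (inj₂ uv))   = reach-mono graph 2 u v (s≤s z≤n) (adj⇒reach graph u v uv)

  distanceBalanced : 4 < n → DistanceBalanced graph
  distanceBalanced 4<n = Tr≡⇒distanceBalanced λ x y → +-cancelʳ-≡ 1 (Tr x) (Tr y) (begin
    Tr x + 1                   ≡⟨ Tr+1≡n+nonNeighbours ≤-refl x ⟩
    n + nonNeighbours graph x  ≡⟨ cong (n +_) (trans (nonNeighbours≡2 x) (sym (nonNeighbours≡2 y))) ⟩
    n + nonNeighbours graph y  ≡⟨ Tr+1≡n+nonNeighbours ≤-refl y ⟨
    Tr y + 1                   ∎)
    where
    open ≡-Reasoning
    open Connected graph (proj₁ isSimple) (≤-trans (s≤s (s≤s z≤n)) (<⇒≤ 4<n)) (reach-two 4<n)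

  twice-numEdges : 2 * numEdges graph ≡ n * (n ∸ 3)
  twice-numEdges = handshake-regular graph isSimple λ v →
    sym (trans (cong (_∸ 3) (sym (degree+3 v))) (m+n∸n≡m (degree graph v) 3))

<m+3 : ∀ {m a} → a ≤ suc (suc m) → a < m + 3
<m+3 {m} {a} a≤ = subst (a <_) (+-comm 3 m) (s≤s a≤)

data StarPosition (m a : ℕ) : Set where
  at-o : a ≡ 0 → StarPosition m a
  at-x : 1 ≤ a → a ≤ m → StarPosition m a
  at-y : a ≡ suc m → StarPosition m a
  at-z : a ≡ suc (suc m) → StarPosition m a

starPosition : ∀ m a → a < m + 3 → StarPosition m a
starPosition m zero    _ = at-o refl
starPosition m (suc a) a<m+3 with <-cmp a m
... | tri< a<m _ _   = at-x (s≤s z≤n) a<m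
... | tri≈ _ refl _  = at-y refl
... | tri> _ _ a>m with <-cmp a (suc m)
...   | tri< a<1+m _ _ = ⊥-elim (<⇒≱ a>m (≤-pred a<1+m))
...   | tri≈ _ refl _  = at-z refl
...   | tri> _ _ a>1+m = ⊥-elim (<⇒≱ a>1+m (≤-pred (≤-pred (subst (suc a <_) (+-comm m 3) a<m+3))))

starEdge-o-x : ∀ m k → 1 ≤ k → k ≤ m → starEdge m 0 k ≡ true
starEdge-o-x m k 1≤k k≤m rewrite dec-true (0 <? k) 1≤k | dec-true (k <? suc m) (s≤s k≤m) = refl

starEdge-x₁-y : ∀ m → starEdge m 1 (suc m) ≡ true
starEdge-x₁-y m rewrite ≡ᵇ-refl m = refl

starEdge-y-z : ∀ m → starEdge m (suc m) (suc (suc m)) ≡ true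
starEdge-y-z m rewrite ≡ᵇ-refl m | ∨-zeroʳ ((m ≡ᵇ 0) ∧ (suc (suc m) ≡ᵇ suc m)) = refl

starEdge⁻¹ : ∀ m a b → starEdge m a b ≡ true →
             (a ≡ 0 × 1 ≤ b × b ≤ m) ⊎ (a ≡ 1 × b ≡ suc m) ⊎ (a ≡ suc m × b ≡ suc (suc m))
starEdge⁻¹ m a b e with ∨-true⁻¹ {(a ≡ᵇ 0) ∧ (0 <ᵇ b) ∧ (b <ᵇ suc m)} e
... | inj₁ e₁ =
  let a=0 , r = ∧-true⁻¹ {a ≡ᵇ 0} e₁ ; 0<b , b<1+m = ∧-true⁻¹ {0 <ᵇ b} r
  in inj₁ (dec-true⁻¹ (a ≟ 0) a=0 , dec-true⁻¹ (0 <? b) 0<b , ≤-pred (dec-true⁻¹ (b <? suc m) b<1+m))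
... | inj₂ e′ with ∨-true⁻¹ {(a ≡ᵇ 1) ∧ (b ≡ᵇ suc m)} e′
...   | inj₁ e₂ = let a=1 , b=y = ∧-true⁻¹ {a ≡ᵇ 1} e₂
                  in inj₂ (inj₁ (dec-true⁻¹ (a ≟ 1) a=1 , dec-true⁻¹ (b ≟ suc m) b=y))
...   | inj₂ e₃ = let a=y , b=z = ∧-true⁻¹ {a ≡ᵇ suc m} e₃
                  in inj₂ (inj₂ (dec-true⁻¹ (a ≟ suc m) a=y , dec-true⁻¹ (b ≟ suc (suc m)) b=z))

starEdge-< : ∀ m a b → 1 ≤ m → starEdge m a b ≡ true → a < b
starEdge-< m a b 1≤m e with starEdge⁻¹ m a b e
... | inj₁ (refl , 1≤b , _)    = 1≤b
... | inj₂ (inj₁ (refl , refl)) = s≤s 1≤m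
... | inj₂ (inj₂ (refl , refl)) = ≤-refl

𝟙-ordered-starEdge : ∀ m a b → 1 ≤ m →
                     𝟙 ((a <ᵇ b) ∧ (starEdge m a b ∨ starEdge m b a)) ≡ 𝟙 (starEdge m a b)
𝟙-ordered-starEdge m a b 1≤m with starEdge m a b in ab | starEdge m b a in ba
... | true  | _     rewrite dec-true (a <? b) (starEdge-< m a b 1≤m ab) = refl
... | false | true  rewrite dec-false (a <? b) (<⇒≯ (starEdge-< m b a 1≤m ba)) = refl
... | false | false rewrite ∧-zeroʳ (a <ᵇ b) = refl

𝟙-starEdge : ∀ m a b → 1 ≤ m →
             𝟙 (starEdge m a b) ≡ 𝟙 ((a ≡ᵇ 0) ∧ (0 <ᵇ b) ∧ (b <ᵇ suc m))
                                  + (𝟙 ((a ≡ᵇ 1) ∧ (b ≡ᵇ suc m)) + 𝟙 ((a ≡ᵇ suc m) ∧ (b ≡ᵇ suc (suc m))))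
𝟙-starEdge m a b 1≤m =
  trans (𝟙-∨ _ _ o-x-only) (cong (𝟙 ((a ≡ᵇ 0) ∧ (0 <ᵇ b) ∧ (b <ᵇ suc m)) +_) (𝟙-∨ _ _ x₁-y-only))
  where
  o-x-only : (a ≡ᵇ 0) ∧ (0 <ᵇ b) ∧ (b <ᵇ suc m) ≡ true →
             ((a ≡ᵇ 1) ∧ (b ≡ᵇ suc m)) ∨ ((a ≡ᵇ suc m) ∧ (b ≡ᵇ suc (suc m))) ≡ false
  o-x-only e rewrite dec-true⁻¹ (a ≟ 0) (proj₁ (∧-true⁻¹ {a ≡ᵇ 0} e)) = refl
  x₁-y-only : (a ≡ᵇ 1) ∧ (b ≡ᵇ suc m) ≡ true → (a ≡ᵇ suc m) ∧ (b ≡ᵇ suc (suc m)) ≡ false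
  x₁-y-only e rewrite dec-true⁻¹ (a ≟ 1) (proj₁ (∧-true⁻¹ {a ≡ᵇ 1} e)) | ≡ᵇ-≢ (<⇒≢ 1≤m) = refl

numEdges-star : ∀ m → 1 ≤ m → numEdges (S3-1 m) ≡ m + 2
numEdges-star m 1≤m = begin
  numEdges (S3-1 m)
    ≡⟨ numEdges-∑ (S3-1 m) ⟩
  ∑[ i < n ] ∑[ j < n ] 𝟙 ((toℕ i <ᵇ toℕ j) ∧ adj (S3-1 m) i j)
    ≡⟨ ∑∑-cong {n} (λ i j → trans (𝟙-ordered-starEdge m (toℕ i) (toℕ j) 1≤m)
                                  (𝟙-starEdge m (toℕ i) (toℕ j) 1≤m)) ⟩
  ∑[ i < n ] ∑[ j < n ] (o-x i j + (x₁-y i j + y-z i j))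
    ≡⟨ trans (∑∑-distrib-+ n o-x _) (cong (∑[ i < n ] ∑[ j < n ] o-x i j +_) (∑∑-distrib-+ n x₁-y y-z)) ⟩
  ∑[ i < n ] ∑[ j < n ] o-x i j + (∑[ i < n ] ∑[ j < n ] x₁-y i j + ∑[ i < n ] ∑[ j < n ] y-z i j)
    ≡⟨ cong₂ _+_ (∑∑-𝟙-∧ n (is 0) (λ j → (0 <ᵇ toℕ j) ∧ (toℕ j <ᵇ suc m)))
                 (cong₂ _+_ (∑∑-𝟙-∧ n (is 1) (is (suc m)))
                            (∑∑-𝟙-∧ n (is (suc m)) (is (suc (suc m))))) ⟩
  ∑[ i < n ] 𝟙 (is 0 i) * ∑[ j < n ] 𝟙 ((0 <ᵇ toℕ j) ∧ (toℕ j <ᵇ suc m))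
    + (∑[ i < n ] 𝟙 (is 1 i) * ∑[ j < n ] 𝟙 (is (suc m) j)
       + ∑[ i < n ] 𝟙 (is (suc m) i) * ∑[ j < n ] 𝟙 (is (suc (suc m)) j))
    ≡⟨ cong₂ _+_ (cong₂ _*_ (once 0 z≤n) (∑-𝟙-between n m (<m+3 (m≤n⇒m≤1+n (n≤1+n m)))))
                 (cong₂ _+_ (cong₂ _*_ (once 1 (s≤s z≤n)) (once (suc m) (n≤1+n (suc m))))
                            (cong₂ _*_ (once (suc m) (n≤1+n (suc m))) (once (suc (suc m)) ≤-refl))) ⟩
  1 * m + 2
    ≡⟨ cong (_+ 2) (*-identityˡ m) ⟩
  m + 2 ∎
  where
  open ≡-Reasoning
  n = m + 3
  is : ℕ → Fin n → Bool
  is a i = toℕ i ≡ᵇ a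
  once : ∀ a → a ≤ suc (suc m) → ∑[ i < n ] 𝟙 (is a i) ≡ 1
  once a a≤ = ∑-𝟙-≡ᵇ n a (<m+3 a≤)
  o-x x₁-y y-z : Fin n → Fin n → ℕ
  o-x  i j = 𝟙 (is 0 i ∧ (0 <ᵇ toℕ j) ∧ (toℕ j <ᵇ suc m))
  x₁-y i j = 𝟙 (is 1 i ∧ is (suc m) j)
  y-z  i j = 𝟙 (is (suc m) i ∧ is (suc (suc m)) j)

-- Lower bound

module LowerBound (m : ℕ) (3≤m : 3 ≤ m) (H : Graph (m + 3)) (simple : IsSimple H)
                  (tree⊆H : S3-1 m ⊆G H) (balanced : DistanceBalanced H) where

  n : ℕ
  n = m + 3

  o x₁ y z : Fin n
  o  = fromℕ< (<m+3 z≤n)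
  x₁ = fromℕ< (<m+3 (s≤s z≤n))
  y  = fromℕ< (<m+3 (n≤1+n (suc m)))
  z  = fromℕ< (<m+3 ≤-refl)

  toℕ-o : toℕ o ≡ 0
  toℕ-o = toℕ-fromℕ< _
  toℕ-x₁ : toℕ x₁ ≡ 1
  toℕ-x₁ = toℕ-fromℕ< _
  toℕ-y : toℕ y ≡ suc m
  toℕ-y = toℕ-fromℕ< _
  toℕ-z : toℕ z ≡ suc (suc m)
  toℕ-z = toℕ-fromℕ< _

  position : ∀ u → StarPosition m (toℕ u)
  position u = starPosition m (toℕ u) (toℕ<n u)

  is-o : ∀ {u} → toℕ u ≡ 0 → u ≡ o
  is-o e = toℕ-injective (trans e (sym toℕ-o))
  is-y : ∀ {u} → toℕ u ≡ suc m → u ≡ y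
  is-y e = toℕ-injective (trans e (sym toℕ-y))
  is-z : ∀ {u} → toℕ u ≡ suc (suc m) → u ≡ z
  is-z e = toℕ-injective (trans e (sym toℕ-z))

  tree-edge : ∀ u v → starEdge m (toℕ v) (toℕ u) ≡ true → adj H u v ≡ true
  tree-edge u v e = tree⊆H u v (trans (cong (starEdge m (toℕ u) (toℕ v) ∨_) e) (∨-zeroʳ _))

  x→o : ∀ u → 1 ≤ toℕ u → toℕ u ≤ m → adj H u o ≡ true
  x→o u 1≤u u≤m =
    tree-edge u o (subst (λ a → starEdge m a (toℕ u) ≡ true) (sym toℕ-o) (starEdge-o-x m (toℕ u) 1≤u u≤m))

  x₁→o : adj H x₁ o ≡ true
  x₁→o = x→o x₁ (≤-reflexive (sym toℕ-x₁)) (subst (_≤ m) (sym toℕ-x₁) (≤-trans (s≤s z≤n) 3≤m))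

  y→x₁ : adj H y x₁ ≡ true
  y→x₁ = tree-edge y x₁
    (subst₂ (λ a b → starEdge m a b ≡ true) (sym toℕ-x₁) (sym toℕ-y) (starEdge-x₁-y m))

  z→y : adj H z y ≡ true
  z→y = tree-edge z y (subst₂ (λ a b → starEdge m a b ≡ true) (sym toℕ-y) (sym toℕ-z) (starEdge-y-z m))

  adj-sym : ∀ u v → adj H u v ≡ adj H v u
  adj-sym = proj₁ simple

  reach-y-o : reach H 2 y o ≡ true
  reach-y-o = reach-trans H 1 1 y x₁ o (adj⇒reach H y x₁ y→x₁) (adj⇒reach H x₁ o x₁→o)

  near-o : ∀ u → toℕ u ≤ m → reach H 1 u o ≡ true
  near-o u u≤m with position u
  ... | at-o e   rewrite is-o e = reach-mono H 1 o o z≤n (reach-refl H o)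
  ... | at-x p q = adj⇒reach H u o (x→o u p q)
  ... | at-y e   = ⊥-elim (<⇒≱ ≤-refl (subst (_≤ m) e u≤m))
  ... | at-z e   = ⊥-elim (<⇒≱ (n≤1+n _) (subst (_≤ m) e u≤m))

  reach-o : ∀ u → reach H 3 u o ≡ true
  reach-o u with position u
  ... | at-o e   = reach-mono H 3 u o (s≤s z≤n) (near-o u (≤-trans (≤-reflexive e) z≤n))
  ... | at-x p q = reach-mono H 3 u o (s≤s z≤n) (near-o u q)
  ... | at-y e   rewrite is-y e = reach-mono H 3 y o (s≤s (s≤s z≤n)) reach-y-o
  ... | at-z e   rewrite is-z e = reach-trans H 1 2 z y o (adj⇒reach H z y z→y) reach-y-o

  6≤n : 6 ≤ n
  6≤n = subst (6 ≤_) (+-comm 3 m) (s≤s (s≤s (s≤s 3≤m)))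

  open Connected H adj-sym 6≤n (λ u v → reach-trans H 3 3 u o v (reach-o u) (reach-sym H adj-sym 3 v o (reach-o v)))

  Tr-y≡Tr-o : Tr y ≡ Tr o
  Tr-y≡Tr-o = trans (distanceBalanced⇒Tr≡ balanced y→x₁) (distanceBalanced⇒Tr≡ balanced x₁→o)

  Tr≡Tr-o : ∀ v → Tr v ≡ Tr o
  Tr≡Tr-o v with position v
  ... | at-o e   = cong Tr (is-o e)
  ... | at-x p q = distanceBalanced⇒Tr≡ balanced (x→o v p q)
  ... | at-y e   = trans (cong Tr (is-y e)) Tr-y≡Tr-o
  ... | at-z e   = trans (cong Tr (is-z e)) (trans (distanceBalanced⇒Tr≡ balanced z→y) Tr-y≡Tr-o)

  D : ℕ
  D = d z o

  -- Read off the tree, d u o + 𝟙 (u == z) is at most 0, 1, 2, 1 + D at u = o, xᵢ, y, z; the summand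
  -- 𝟙 (u == z) avoids the truncated subtraction D ∸ 1.
  profile : Fin n → ℕ
  profile u = 𝟙 (not (u == o)) + 𝟙 (u == y) + 𝟙 (u == z) * D

  private
    Bounded : ℕ → Bool → Bool → Bool → Set
    Bounded k eo ey ez = k + 𝟙 ez ≤ 𝟙 (not eo) + 𝟙 ey + 𝟙 ez * D

    bounded-o : ∀ {k eo ey ez} → eo ≡ true → ey ≡ false → ez ≡ false → k ≡ 0 → Bounded k eo ey ez
    bounded-o refl refl refl refl = z≤n

    bounded-x : ∀ {k eo ey ez} → eo ≡ false → ey ≡ false → ez ≡ false → k ≤ 1 → Bounded k eo ey ez
    bounded-x {k} refl refl refl k≤1 = ≤-trans (≤-reflexive (+-identityʳ k)) k≤1

    bounded-y : ∀ {k eo ey ez} → eo ≡ false → ey ≡ true → ez ≡ false → k ≤ 2 → Bounded k eo ey ez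
    bounded-y {k} refl refl refl k≤2 = ≤-trans (≤-reflexive (+-identityʳ k)) k≤2

    bounded-z : ∀ {k eo ey ez} → eo ≡ false → ey ≡ false → ez ≡ true → k ≡ D → Bounded k eo ey ez
    bounded-z refl refl refl refl = ≤-reflexive (trans (+-comm D 1) (cong suc (sym (+-identityʳ D))))

  d-o≤profile : ∀ u → d u o + 𝟙 (u == z) ≤ profile u
  d-o≤profile u with position u
  ... | at-o e   = bounded-o (==-via {u = u} e toℕ-o) (==-via {u = u} e toℕ-y) (==-via {u = u} e toℕ-z)
                     (trans (cong (λ w → d w o) (is-o e)) (d-self o))
  ... | at-x p q = bounded-x (trans (==-via {u = u} refl toℕ-o) (≡ᵇ-≢ (>⇒≢ p)))
                             (trans (==-via {u = u} refl toℕ-y) (≡ᵇ-≢ (<⇒≢ (s≤s q))))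
                             (trans (==-via {u = u} refl toℕ-z) (≡ᵇ-≢ (<⇒≢ (s≤s (m≤n⇒m≤1+n q)))))
                             (d-minimal 1 u o (near-o u q))
  ... | at-y e   = bounded-y (==-via {u = u} e toℕ-o)
                             (trans (==-via {u = u} e toℕ-y) (≡ᵇ-refl m))
                             (trans (==-via {u = u} e toℕ-z) (≡ᵇ-≢ {m} (<⇒≢ ≤-refl)))
                             (d-minimal 2 u o (subst (λ w → reach H 2 w o ≡ true) (sym (is-y e)) reach-y-o))
  ... | at-z e   = bounded-z (==-via {u = u} e toℕ-o)
                             (trans (==-via {u = u} e toℕ-y) (≡ᵇ-≢ {suc m} (>⇒≢ ≤-refl)))
                             (trans (==-via {u = u} e toℕ-z) (≡ᵇ-refl m))
                             (cong (λ w → d w o) (is-z e))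

  Tr-o-bound : Tr o + 1 ≤ n + D
  Tr-o-bound = begin
    Tr o + 1
      ≡⟨ cong (Tr o +_) (∑-𝟙-== z) ⟨
    Tr o + ∑[ u < n ] 𝟙 (u == z)
      ≡⟨ ∑-distrib-+ (λ u → d u o) (λ u → 𝟙 (u == z)) ⟨
    ∑[ u < n ] (d u o + 𝟙 (u == z))
      ≤⟨ ∑-mono-≤ d-o≤profile ⟩
    ∑[ u < n ] profile u
      ≡⟨ ∑-distrib-+ (λ u → 𝟙 (not (u == o)) + 𝟙 (u == y)) (λ u → 𝟙 (u == z) * D) ⟩
    ∑[ u < n ] (𝟙 (not (u == o)) + 𝟙 (u == y)) + ∑[ u < n ] (𝟙 (u == z) * D)
      ≡⟨ cong₂ _+_ (∑-distrib-+ (λ u → 𝟙 (not (u == o))) (λ u → 𝟙 (u == y)))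
                   (sym (*-distribʳ-sum D (λ u → 𝟙 (u == z)))) ⟩
    ∑[ u < n ] 𝟙 (not (u == o)) + ∑[ u < n ] 𝟙 (u == y) + ∑[ u < n ] 𝟙 (u == z) * D
      ≡⟨ cong₂ _+_ (cong (∑[ u < n ] 𝟙 (not (u == o)) +_) (∑-𝟙-== y)) (cong (_* D) (∑-𝟙-== z)) ⟩
    ∑[ u < n ] 𝟙 (not (u == o)) + 1 + 1 * D
      ≡⟨ cong₂ _+_ (∑-𝟙-≢ o) (*-identityˡ D) ⟩
    n + D ∎
    where open ≤-Reasoning

  nonNeighbours≤D : ∀ v → nonNeighbours H v ≤ D
  nonNeighbours≤D v = +-cancelˡ-≤ n (nonNeighbours H v) D (begin
    n + nonNeighbours H v  ≤⟨ n+nonNeighbours≤Tr+1 v ⟩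
    Tr v + 1               ≡⟨ cong (_+ 1) (Tr≡Tr-o v) ⟩
    Tr o + 1               ≤⟨ Tr-o-bound ⟩
    n + D                  ∎)
    where open ≤-Reasoning

  far-from-z : 3 ≤ D → ∀ u → toℕ u ≤ m → adj H u z ≡ false
  far-from-z 3≤D u u≤m with adj H u z in uz
  ... | false = refl
  ... | true  = ⊥-elim (<⇒≱ 3≤D (d-minimal 2 z o
                  (reach-trans H 1 1 z u o (adj⇒reach H z u (trans (adj-sym z u) uz)) (near-o u u≤m))))

  D≤2 : D ≤ 2
  D≤2 = ≤-pred (≰⇒> λ 3≤D → <⇒≱ (s≤s 3≤m) (begin
    suc m
      ≡⟨ ∑-𝟙-<ᵇ n (suc m) (<⇒≤ (<m+3 (n≤1+n (suc m)))) ⟨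
    ∑[ u < n ] 𝟙 (toℕ u <ᵇ suc m)
      ≤⟨ ∑-mono-≤ (λ u → 𝟙-≤ (non-neighbour-of-z 3≤D u ∘ ≤-pred ∘ dec-true⁻¹ (_ <? _))) ⟩
    nonNeighbours H z
      ≤⟨ nonNeighbours≤D z ⟩
    D
      ≤⟨ d-minimal 3 z o (reach-o z) ⟩
    3 ∎))
    where
    open ≤-Reasoning
    non-neighbour-of-z : 3 ≤ D → ∀ u → toℕ u ≤ m → 1 ≤ 𝟙 (not (u == z) ∧ not (adj H u z))
    non-neighbour-of-z 3≤D u u≤m = ≤-reflexive (sym (𝟙-nonNeighbour H
      (trans (==-via {u = u} refl toℕ-z) (≡ᵇ-≢ (<⇒≢ (s≤s (m≤n⇒m≤1+n u≤m))))) (far-from-z 3≤D u u≤m)))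

  m≤degree : ∀ v → m ≤ degree H v
  m≤degree v = +-cancelʳ-≤ 3 m (degree H v) (begin
    m + 3
      ≡⟨ degree+nonNeighbours H simple v ⟨
    degree H v + nonNeighbours H v + 1
      ≤⟨ +-monoˡ-≤ 1 (+-monoʳ-≤ (degree H v) (≤-trans (nonNeighbours≤D v) D≤2)) ⟩
    degree H v + 2 + 1
      ≡⟨ +-assoc (degree H v) 2 1 ⟩
    degree H v + 3 ∎)
    where open ≤-Reasoning

  twice-numEdges-≥ : n * m ≤ 2 * numEdges H
  twice-numEdges-≥ = handshake-minDegree H simple m≤degree

-- Upper bound

-- The Hamiltonian cycle o → z → x₁ → x₂ → ⋯ → xₘ → y → o and its inverse, in the labels of S3-1
-- (o = 0, xᵢ = i, y = m + 1, z = m + 2). No tree edge joins consecutive vertices of it.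
next prev : ℕ → ℕ → ℕ
next m zero    = suc (suc m)
next m (suc a) = if a ≡ᵇ m then 0 else if a ≡ᵇ suc m then 1 else suc (suc a)
prev m zero          = suc m
prev m (suc zero)    = suc (suc m)
prev m (suc (suc a)) = if a ≡ᵇ m then 0 else suc a

module StarCycle (m : ℕ) (2≤m : 2 ≤ m) where

  1≤m : 1 ≤ m
  1≤m = ≤-trans (s≤s z≤n) 2≤m

  next-x : ∀ a → 1 ≤ a → a ≤ m → next m a ≡ suc a
  next-x (suc a) _ a<m rewrite ≡ᵇ-≢ (<⇒≢ a<m) | ≡ᵇ-≢ (<⇒≢ (m<n⇒m<1+n a<m)) = refl

  next-y : next m (suc m) ≡ 0
  next-y rewrite ≡ᵇ-refl m = refl

  next-z : next m (suc (suc m)) ≡ 1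
  next-z rewrite ≡ᵇ-≢ {suc m} (>⇒≢ ≤-refl) | ≡ᵇ-refl m = refl

  prev-suc : ∀ b → 1 ≤ b → b ≤ m → prev m (suc b) ≡ b
  prev-suc (suc a) _ a<m rewrite ≡ᵇ-≢ (<⇒≢ a<m) = refl

  prev-z : prev m (suc (suc m)) ≡ 0
  prev-z rewrite ≡ᵇ-refl m = refl

  prev-next : ∀ a → StarPosition m a → prev m (next m a) ≡ a
  prev-next a (at-o refl)    = prev-z
  prev-next a (at-x 1≤a a≤m) rewrite next-x a 1≤a a≤m = prev-suc a 1≤a a≤m
  prev-next a (at-y refl)    rewrite next-y = refl
  prev-next a (at-z refl)    rewrite next-z = refl

  next-prev : ∀ a → StarPosition m a → next m (prev m a) ≡ a
  next-prev a                     (at-o refl) = next-y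
  next-prev (suc zero)            (at-x _ _)  = next-z
  next-prev (suc (suc b))         (at-x _ a≤m)
    rewrite prev-suc (suc b) (s≤s z≤n) (≤-trans (n≤1+n _) a≤m)
    = next-x (suc b) (s≤s z≤n) (≤-trans (n≤1+n _) a≤m)
  next-prev a                     (at-y refl) rewrite prev-suc m 1≤m ≤-refl = next-x m 1≤m ≤-refl
  next-prev a                     (at-z refl) rewrite prev-z = refl

  next-≤ : ∀ a → StarPosition m a → next m a ≤ suc (suc m)
  next-≤ a (at-o refl)    = ≤-refl
  next-≤ a (at-x 1≤a a≤m) rewrite next-x a 1≤a a≤m = s≤s (m≤n⇒m≤1+n a≤m)
  next-≤ a (at-y refl)    rewrite next-y = z≤n
  next-≤ a (at-z refl)    rewrite next-z = s≤s z≤n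

  prev-≤ : ∀ a → StarPosition m a → prev m a ≤ suc (suc m)
  prev-≤ a             (at-o refl)  = n≤1+n (suc m)
  prev-≤ (suc zero)    (at-x _ _)   = ≤-refl
  prev-≤ (suc (suc b)) (at-x _ a≤m)
    rewrite prev-suc (suc b) (s≤s z≤n) (≤-trans (n≤1+n _) a≤m)
    = m≤n⇒m≤1+n (m≤n⇒m≤1+n (≤-trans (n≤1+n _) a≤m))
  prev-≤ a             (at-y refl)  rewrite prev-suc m 1≤m ≤-refl = m≤n⇒m≤1+n (n≤1+n m)
  prev-≤ a             (at-z refl)  rewrite prev-z = z≤n

  next-fixfree : ∀ a → StarPosition m a → next m a ≢ a
  next-fixfree a (at-o refl)    = λ ()
  next-fixfree a (at-x 1≤a a≤m) rewrite next-x a 1≤a a≤m = 1+n≢n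
  next-fixfree a (at-y refl)    rewrite next-y = λ ()
  next-fixfree a (at-z refl)    rewrite next-z = λ ()

  next²-fixfree : ∀ a → StarPosition m a → next m (next m a) ≢ a
  next²-fixfree a (at-o refl)    rewrite next-z = λ ()
  next²-fixfree a (at-x 1≤a a≤m) rewrite next-x a 1≤a a≤m with m≤n⇒m<n∨m≡n a≤m
  ... | inj₁ a<m  rewrite next-x (suc a) (s≤s z≤n) a<m = >⇒≢ (m<n⇒m<1+n ≤-refl)
  ... | inj₂ refl rewrite next-y = <⇒≢ 1≤m
  next²-fixfree a (at-y refl)    rewrite next-y = 1+n≢n
  next²-fixfree a (at-z refl)    rewrite next-z | next-x 1 ≤-refl 1≤m = <⇒≢ 1≤m ∘ suc-injective ∘ suc-injective

  tree-avoids-cycle : ∀ a b → starEdge m a b ≡ true → b ≢ next m a × a ≢ next m b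
  tree-avoids-cycle a b e with starEdge⁻¹ m a b e
  ... | inj₁ (refl , 1≤b , b≤m)   rewrite next-x b 1≤b b≤m = <⇒≢ (s≤s (m≤n⇒m≤1+n b≤m)) , λ ()
  ... | inj₂ (inj₁ (refl , refl)) rewrite next-x 1 ≤-refl 1≤m | next-y =
          <⇒≢ 2≤m ∘ sym ∘ suc-injective , λ ()
  ... | inj₂ (inj₂ (refl , refl)) rewrite next-y | next-z = (λ ()) , <⇒≢ 1≤m ∘ sym ∘ suc-injective

  position : (v : Fin (m + 3)) → StarPosition m (toℕ v)
  position v = starPosition m (toℕ v) (toℕ<n v)

  s p : Fin (m + 3) → Fin (m + 3)
  s v = fromℕ< (<m+3 (next-≤ (toℕ v) (position v)))
  p v = fromℕ< (<m+3 (prev-≤ (toℕ v) (position v)))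

  toℕ-s : ∀ v → toℕ (s v) ≡ next m (toℕ v)
  toℕ-s v = toℕ-fromℕ< _

  toℕ-p : ∀ v → toℕ (p v) ≡ prev m (toℕ v)
  toℕ-p v = toℕ-fromℕ< _

  s∘p : ∀ v → s (p v) ≡ v
  s∘p v = toℕ-injective (trans (toℕ-s (p v)) (trans (cong (next m) (toℕ-p v)) (next-prev (toℕ v) (position v))))

  p∘s : ∀ v → p (s v) ≡ v
  p∘s v = toℕ-injective (trans (toℕ-p (s v)) (trans (cong (prev m) (toℕ-s v)) (prev-next (toℕ v) (position v))))

  s-fixfree : ∀ v → s v ≢ v
  s-fixfree v sv≡v = next-fixfree (toℕ v) (position v) (trans (sym (toℕ-s v)) (cong toℕ sv≡v))

  s²-fixfree : ∀ v → s (s v) ≢ v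
  s²-fixfree v ssv≡v = next²-fixfree (toℕ v) (position v)
    (trans (cong (next m) (sym (toℕ-s v))) (trans (sym (toℕ-s (s v))) (cong toℕ ssv≡v)))

  open CycleComplement s p s∘p p∘s s-fixfree s²-fixfree public

  tree-edge-avoids : ∀ u v → starEdge m (toℕ u) (toℕ v) ≡ true → u ≢ v × v ≢ s u × u ≢ s v
  tree-edge-avoids u v e =
    let v≢next , u≢next = tree-avoids-cycle (toℕ u) (toℕ v) e in
    <⇒≢ (starEdge-< m (toℕ u) (toℕ v) 1≤m e) ∘ cong toℕ ,
    (λ v≡su → v≢next (trans (cong toℕ v≡su) (toℕ-s u))) ,
    (λ u≡sv → u≢next (trans (cong toℕ u≡sv) (toℕ-s v)))

  tree⊆graph : S3-1 m ⊆G graph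
  tree⊆graph u v e with ∨-true⁻¹ {starEdge m (toℕ u) (toℕ v)} e
  ... | inj₁ uv = let u≢v , v≢su , u≢sv = tree-edge-avoids u v uv in adj-intro u≢v v≢su u≢sv
  ... | inj₂ vu = let v≢u , u≢sv , v≢su = tree-edge-avoids v u vu in adj-intro (≢-sym v≢u) v≢su u≢sv

  twice-numEdges-graph : 2 * numEdges graph ≡ (m + 3) * m
  twice-numEdges-graph = trans twice-numEdges (cong ((m + 3) *_) (m+n∸n≡m m 3))

  4<m+3 : 4 < m + 3
  4<m+3 = <m+3 (s≤s (s≤s 2≤m))

m²+m≡2N+4 : ∀ m → 2 ≤ m → ∃ λ N → m * m + m ≡ 2 * N + 4
m²+m≡2N+4 (suc (suc zero))    _ = 1 , refl
m²+m≡2N+4 (suc zero) (s≤s ())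
m²+m≡2N+4 (suc (suc (suc k))) _ with N , e ← m²+m≡2N+4 (2 + k) (s≤s (s≤s z≤n)) = N + (3 + k) , (begin
  (3 + k) * (3 + k) + (3 + k)                   ≡⟨ solve (k ∷ []) ⟩
  ((2 + k) * (2 + k) + (2 + k)) + 2 * (3 + k)   ≡⟨ cong (_+ 2 * (3 + k)) e ⟩
  2 * N + 4 + 2 * (3 + k)                       ≡⟨ solve (N ∷ k ∷ []) ⟩
  2 * (N + (3 + k)) + 4                         ∎)
  where open ≡-Reasoning

twice-optimal-size : ∀ m → 2 ≤ m → 2 * (m + 2 + (m * m + m ∸ 4) / 2) ≡ (m + 3) * m
twice-optimal-size m 2≤m with N , e ← m²+m≡2N+4 m 2≤m = begin
  2 * (m + 2 + (m * m + m ∸ 4) / 2)   ≡⟨ cong (λ t → 2 * (m + 2 + (t ∸ 4) / 2)) e ⟩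
  2 * (m + 2 + (2 * N + 4 ∸ 4) / 2)   ≡⟨ cong (λ t → 2 * (m + 2 + t / 2)) (m+n∸n≡m (2 * N) 4) ⟩
  2 * (m + 2 + 2 * N / 2)             ≡⟨ cong (λ t → 2 * (m + 2 + t / 2)) (*-comm 2 N) ⟩
  2 * (m + 2 + N * 2 / 2)             ≡⟨ cong (λ t → 2 * (m + 2 + t)) (m*n/n≡m N 2) ⟩
  2 * (m + 2 + N)                     ≡⟨ solve (m ∷ N ∷ []) ⟩
  (2 * N + 4) + 2 * m                 ≡⟨ cong (_+ 2 * m) e ⟨
  (m * m + m) + 2 * m                 ≡⟨ solve (m ∷ []) ⟩
  (m + 3) * m                         ∎
  where open ≡-Reasoning

theorem4p6 : (m : ℕ) → 3 ≤ m → IsBalancingNumber (S3-1 m) ((m * m + m ∸ 4) / 2)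
theorem4p6 m 3≤m = (graph , isSimple , tree⊆graph , distanceBalanced 4<m+3 , size-of-graph) , minimal
  where
  2≤m : 2 ≤ m
  2≤m = ≤-trans (n≤1+n 2) 3≤m
  open StarCycle m 2≤m
  b : ℕ
  b = (m * m + m ∸ 4) / 2
  twice-optimum : 2 * (numEdges (S3-1 m) + b) ≡ (m + 3) * m
  twice-optimum = trans (cong (λ e → 2 * (e + b)) (numEdges-star m 1≤m)) (twice-optimal-size m 2≤m)
  size-of-graph : numEdges graph ≡ numEdges (S3-1 m) + b
  size-of-graph = *-cancelˡ-≡ _ _ 2 (trans twice-numEdges-graph (sym twice-optimum))
  minimal : ∀ H → IsSimple H → S3-1 m ⊆G H → DistanceBalanced H → numEdges (S3-1 m) + b ≤ numEdges H
  minimal H simple tree⊆H balanced = *-cancelˡ-≤ 2 (begin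
    2 * (numEdges (S3-1 m) + b)  ≡⟨ twice-optimum ⟩
    (m + 3) * m                  ≤⟨ LowerBound.twice-numEdges-≥ m 3≤m H simple tree⊆H balanced ⟩
    2 * numEdges H               ∎)
    where open ≤-Reasoning
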